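{- Let $\langle W,R,S,v\rangle$ be a PS4 model and let $w_1,\dots,w_n\in W$ with $w_jRw_{j+1}$ for all $1\le j<n$, and let $1<i<n$. Then there are points $w'_{i+1},\dots,w'_n\in W$ such that $w_1,\dots,w_{i-1},w'_{i+1},\dots,w'_n$ is again a sequence in which each point is $R$-related to the next (i.e. $w_{i-1}Rw'_{i+1}$ and $w'_jRw'_{j+1}$ for $i+1\le j<n$, besides $w_jRw_{j+1}$ for $j<i-1$), and $w_jSw'_j$ for all $i+1\le j\le n$.
   Context: A PS4 frame is $\langle W,R,S\rangle$ with $W\neq\emptyset$ and $R,S\subseteq W\times W$ such that: $S$ is reflexive; $R$ is reflexive; (Pseudo-Transitivity) if $xRy$ and $yRz$ then there is $w$ with $xRw$ and $zSw$; (Forth) if $xRy$ and $xSz$ then there is $w$ with $zRw$ and $ySw$; (Back) if $xSz$ and $zRw$ then there is $y$ with $xRy$ and $ySw$. A PS4 model is a PS4 frame together with a three-valued (strong Kleene) valuation; the valuation plays no role in this statement. -}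

module Defs where

open import Level using (Level; _⊔_; suc)
open import Data.Product using (Σ; ∃; _×_; _,_)
open import Relation.Binary using (Rel; Reflexive)

-- strong Kleene truth values
data Three : Set where
  𝟎 ½ 𝟏 : Three

record PS4Frame (a ℓ : Level) : Set (Level.suc (a ⊔ ℓ)) where
  field
    W     : Set a
    inhabited : W
    R     : Rel W ℓ
    S     : Rel W ℓ
    S-refl : Reflexive S
    R-refl : Reflexive R
    pseudo-trans : ∀ {x y z} → R x y → R y z → ∃ λ w → R x w × S z w
    forth : ∀ {x y z} → R x y → S x z → ∃ λ w → R z w × S y w
    back  : ∀ {x z w} → S x z → R z w → ∃ λ y → R x y × S y w

record PS4Model (a ℓ p : Level) (Atom : Set p) : Set (Level.suc (a ⊔ ℓ) ⊔ p) where
  field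
    frame : PS4Frame a ℓ
  open PS4Frame frame public
  field
    v : Atom → W → Three

{-# OPTIONS --safe #-}
module Submission where

-- Pseudo-transitivity applied to w_{i-1} R w_i R w_{i+1} yields a point u with
-- w_{i-1} R u and w_{i+1} S u, which lets the chain skip w_i.  The tail
-- w_{i+1}, …, w_n is then carried along S to a chain starting at u: each step
-- w_j R w_{j+1}, together with w_j S w′_j, gives the next point w′_{j+1} by forth.

open import Defs
open import Level using (Level)
open import Data.Nat using (ℕ; zero; suc; _+_; _∸_; _<_; _≤_; s≤s; z≤n)
open import Data.Nat.Properties
open import Data.Product using (Σ; _×_; _,_)
open import Relation.Binary.PropositionalEquality using (_≡_; refl; sym; trans; cong; subst)

module _ {a ℓ : Level} (F : PS4Frame a ℓ) where
  open PS4Frame F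

  RChain : ℕ → (ℕ → W) → Set ℓ
  RChain n v = ∀ k → k < n → R (v k) (v (k + 1))

  forth-liftChain : ∀ n (v : ℕ → W) → RChain n v → ∀ {u} → S (v 0) u →
    Σ (ℕ → W) λ v′ → v′ 0 ≡ u × RChain n v′ × (∀ k → k ≤ n → S (v k) (v′ k))
  forth-liftChain zero v _ {u} v₀Su = (λ _ → u) , refl , (λ _ ()) , λ { zero z≤n → v₀Su }
  forth-liftChain (suc n) v chain {u} v₀Su
    with forth (chain 0 (s≤s z≤n)) v₀Su
  ... | z , uRz , v₁Sz
    with forth-liftChain n (λ k → v (suc k)) (λ k k<n → chain (suc k) (s≤s k<n)) v₁Sz
  ... | v″ , refl , chain″ , sim″ = v′ , refl , chain′ , sim′
    where
    v′ : ℕ → W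
    v′ zero    = u
    v′ (suc k) = v″ k

    chain′ : RChain (suc n) v′
    chain′ zero    _         = uRz
    chain′ (suc k) (s≤s k<n) = chain″ k k<n

    sim′ : ∀ k → k ≤ suc n → S (v k) (v′ k)
    sim′ zero    _         = v₀Su
    sim′ (suc k) (s≤s k≤n) = sim″ k k≤n

  forth-liftChainFrom : ∀ m n (w : ℕ → W) → m ≤ n →
    (∀ j → m ≤ j → j < n → R (w j) (w (j + 1))) → ∀ {u} → S (w m) u →
    Σ (ℕ → W) λ w′ → w′ m ≡ u
      × (∀ j → m ≤ j → j < n → R (w′ j) (w′ (j + 1)))
      × (∀ j → m ≤ j → j ≤ n → S (w j) (w′ j))
  forth-liftChainFrom m n w m≤n chain {u} wₘSu
    with forth-liftChain (n ∸ m) shifted shiftedChain shiftedSu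
    where
    shifted : ℕ → W
    shifted k = w (m + k)

    shiftedChain : RChain (n ∸ m) shifted
    shiftedChain k k<n∸m =
      subst (λ x → R (shifted k) (w x)) (+-assoc m k 1)
        (chain (m + k) (m≤m+n m k)
          (subst (m + k <_) (m+[n∸m]≡n m≤n) (+-monoʳ-< m k<n∸m)))

    shiftedSu : S (shifted 0) u
    shiftedSu = subst (λ x → S (w x) u) (sym (+-identityʳ m)) wₘSu
  ... | v′ , v′₀≡u , chain′ , sim′ = w′ , trans (cong v′ (n∸n≡0 m)) v′₀≡u , chainʷ , simʷ
    where
    w′ : ℕ → W
    w′ j = v′ (j ∸ m)

    chainʷ : ∀ j → m ≤ j → j < n → R (w′ j) (w′ (j + 1))
    chainʷ j m≤j j<n =
      subst (λ x → R (w′ j) (v′ x)) (sym (+-∸-comm 1 m≤j))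
        (chain′ (j ∸ m) (∸-monoˡ-< j<n m≤j))

    simʷ : ∀ j → m ≤ j → j ≤ n → S (w j) (w′ j)
    simʷ j m≤j j≤n =
      subst (λ x → S (w x) (w′ j)) (m+[n∸m]≡n m≤j) (sim′ (j ∸ m) (∸-monoˡ-≤ m j≤n))

mainTheorem10 : ∀ {a ℓ p} {Atom : Set p} (M : PS4Model a ℓ p Atom) →
    let open PS4Model M in
    (n : ℕ) (w : ℕ → W) →
    (∀ j → 1 ≤ j → j < n → R (w j) (w (j + 1))) →
    (i : ℕ) → 1 < i → i < n →
    Σ (ℕ → W) λ w′ →
      R (w (i ∸ 1)) (w′ (i + 1))
      × (∀ j → i + 1 ≤ j → j < n → R (w′ j) (w′ (j + 1)))
      × (∀ j → i + 1 ≤ j → j ≤ n → S (w j) (w′ j))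
mainTheorem10 M n w chain i 1<i i<n
  with pseudo-trans wᵢ₋₁Rwᵢ (chain i (<⇒≤ 1<i) i<n)
  where
  open PS4Model M
  wᵢ₋₁Rwᵢ : R (w (i ∸ 1)) (w i)
  wᵢ₋₁Rwᵢ = subst (λ x → R (w (i ∸ 1)) (w x)) (m∸n+n≡m (<⇒≤ 1<i))
    (chain (i ∸ 1) (∸-monoˡ-≤ 1 1<i) (≤-<-trans (m∸n≤m i 1) i<n))
... | u , wᵢ₋₁Ru , wᵢ₊₁Su
  with forth-liftChainFrom (PS4Model.frame M) (i + 1) n w (subst (_≤ n) (+-comm 1 i) i<n)
         (λ j i+1≤j → chain j (≤-trans (m≤n+m 1 i) i+1≤j)) wᵢ₊₁Su
... | w′ , refl , chain′ , sim′ = w′ , wᵢ₋₁Ru , chain′ , sim′
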